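{- Let $b\ge3$ be odd, $n$ an even positive integer, and $K$ the transition matrix of the balanced carries chain on $\{ -\tfrac n2,\dots,\tfrac n2\}$ (defined in the context). For $0\le j\le n$ and $-\tfrac n2\le i\le\tfrac n2$ define \[ v_j^n[i]=\sum_{r=0}^{i+n/2}(-1)^r\binom{n+1}{r}(n+2i-2r+1)^{n-j}. \] Then for each $0\le j\le n$, $v_j^n$ is a left eigenvector of $K$ with eigenvalue $1/b^j$, i.e. $\sum_{i=-n/2}^{n/2} v_j^n[i]\,K(i,k)=b^{ -j}v_j^n[k]$ for all $-\tfrac n2\le k\le \tfrac n2$.
   Context: Balanced digits base $b$ ($b$ odd) are the integers $-\tfrac{b-1}{2},\dots,\tfrac{b-1}{2}$. When $n$ numbers in balanced digits are added column by column from right to left, if the carry into a column is $i$ and the column digits are $X_1,\dots,X_n$, the carry out is the unique integer $j$ with $jb-\tfrac{b-1}{2}\le i+X_1+\cdots+X_n\le jb+\tfrac{b-1}{2}$; the first carry is $0$. With all digits independent and uniform on the balanced digit set, the carries form a Markov chain (the balanced carries chain), with state space $\{ -\tfrac n2,\dots,\tfrac n2\}$ for $n$ even; $K(i,j)$ is the probability the carry out is $j$ given carry in $i$. -}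

module Defs where

open import Data.Nat as ℕ using (ℕ; NonZero; _∸_; _^_)
open import Data.Nat.Properties using (m^n≢0)
open import Data.Nat.Combinatorics using (_C_)
open import Data.Integer as ℤ using (ℤ; +_; _-_; -_; ∣_∣)
open import Data.Integer.Properties as ℤP using ()
open import Data.Rational as ℚ using (ℚ; _/_)
open import Data.List using (List; []; _∷_; map; concatMap; upTo; length; filter; foldr)
open import Data.Product using (_×_)
open import Relation.Nullary.Decidable using (Dec; _×-dec_)

half : ℕ → ℕ
half b = (b ∸ 1) ℕ./ 2

balancedRange : ℕ → List ℤ
balancedRange h = map (λ t → (+ t) - (+ h)) (upTo (2 ℕ.* h ℕ.+ 1))

digits : ℕ → List ℤ
digits b = balancedRange (half b)

tuples : ℕ → ℕ → List (List ℤ)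
tuples b ℕ.zero = [] ∷ []
tuples b (ℕ.suc n) = concatMap (λ d → map (d ∷_) (tuples b n)) (digits b)

sumℤ : List ℤ → ℤ
sumℤ = foldr ℤ._+_ (+ 0)

sumℚ : List ℚ → ℚ
sumℚ = foldr ℚ._+_ ℚ.0ℚ

CarryOut : ℕ → ℤ → List ℤ → ℤ → Set
CarryOut b i xs j =
  (j ℤ.* (+ b) - (+ half b) ℤ.≤ i ℤ.+ sumℤ xs) ×
  (i ℤ.+ sumℤ xs ℤ.≤ j ℤ.* (+ b) ℤ.+ (+ half b))

carryOut? : ∀ b i j xs → Dec (CarryOut b i xs j)
carryOut? b i j xs = (_ ℤ.≤? _) ×-dec (_ ℤ.≤? _)

carryCount : ℕ → ℕ → ℤ → ℤ → ℕ
carryCount b n i j = length (filter (carryOut? b i j) (tuples b n))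

-- K(i,j): transition probability of the balanced carries chain
-- (n summands, base b), digits independent uniform on the b balanced digits
K : (b n : ℕ) → .{{NonZero b}} → ℤ → ℤ → ℚ
K b n i j = (+ carryCount b n i j) / (b ^ n) where instance _ = m^n≢0 b n

-- states {-m,…,m} where n = 2m
states : ℕ → List ℤ
states m = balancedRange m

sign : ℕ → ℤ
sign r = (ℤ.- (+ 1)) ℤ.^ r

vvec : (n j : ℕ) → ℤ → ℤ
vvec n j i = sumℤ (map term (upTo (ℕ.suc ∣ i ℤ.+ (+ (n ℕ./ 2)) ∣)))
  where
  term : ℕ → ℤ
  term r = sign r ℤ.* (+ ((n ℕ.+ 1) C r))
             ℤ.* (((+ n) ℤ.+ (+ 2) ℤ.* i - (+ 2) ℤ.* (+ r) ℤ.+ (+ 1)) ℤ.^ (n ∸ j))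

ℤtoℚ : ℤ → ℚ
ℤtoℚ x = x / 1

-- Put n = 2m, p = n - j, b = 2h + 1 and f(t) = (n + 2t + 1)₊^p.  Expanding binomially, the
-- (n+1)-fold backward difference φ = ∇^{n+1} f agrees with v_j^n on the states and vanishes off
-- them: to the left every f(t - r) is 0, to the right f is a polynomial of degree p < n + 1.
-- Counting digit tuples turns b^n Σ_i v[i] K(i,k) into the sum of φ(kb - d₁ - ⋯ - d_{n+1}) over
-- all (n+1)-tuples of digits, and summing over one digit telescopes a step-1 difference into a
-- step-b difference, so the sum is (∇_b)^{n+1} f (kb + (n+1)h).  As f(ub + (n+1)h) = b^p f(u),
-- this is b^p φ(k) = b^p v[k]; dividing by b^n gives the eigenvalue b^{-j}.

module Submission where

open import Defs
open import Data.Nat as ℕ using (ℕ; zero; suc; NonZero; _≤_; _<_; _∸_; _^_; z≤n; s≤s)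
open import Data.Nat.Properties using (m^n≢0)
import Data.Nat.Properties as ℕP
import Data.Nat.DivMod as ℕD
open import Data.Nat.Combinatorics using (_C_; k>n⇒nCk≡0; nCk+nC[k+1]≡[n+1]C[k+1])
open import Data.Integer as ℤ using (ℤ; +_; +[1+_]; -[1+_]; _+_; _-_; _*_; -_; 0ℤ; 1ℤ)
import Data.Integer.Properties as ℤP
open import Data.Integer.Tactic.RingSolver using (solve-∀)
open import Data.Rational as ℚ using (_/_; toℚᵘ)
import Data.Rational.Properties as ℚP
import Data.Rational.Unnormalised as ℚᵘ
import Data.Rational.Unnormalised.Properties as ℚᵘP
open import Data.List using (List; []; _∷_; map; upTo; applyUpTo; concatMap; _++_; filter; length)
open import Data.Product using (∃; _×_; _,_)
open import Data.Empty using (⊥-elim)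
open import Relation.Nullary using (Dec; yes; no; ¬_)
open import Relation.Nullary.Decidable using (_×-dec_)
open import Relation.Binary.PropositionalEquality

∑ : {A : Set} → List A → (A → ℤ) → ℤ
∑ xs g = sumℤ (map g xs)

private
  variable
    A B P Q : Set

∑-cong : (xs : List A) {f g : A → ℤ} → (∀ x → f x ≡ g x) → ∑ xs f ≡ ∑ xs g
∑-cong []       f≗g = refl
∑-cong (x ∷ xs) f≗g = cong₂ _+_ (f≗g x) (∑-cong xs f≗g)

∑-map : (f : A → B) (xs : List A) (g : B → ℤ) → ∑ (map f xs) g ≡ ∑ xs (λ x → g (f x))
∑-map f []       g = refl
∑-map f (x ∷ xs) g = cong (_+_ (g (f x))) (∑-map f xs g)

∑-++ : (xs ys : List A) (g : A → ℤ) → ∑ (xs ++ ys) g ≡ ∑ xs g + ∑ ys g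
∑-++ []       ys g = sym (ℤP.+-identityˡ _)
∑-++ (x ∷ xs) ys g = trans (cong (_+_ (g x)) (∑-++ xs ys g)) (sym (ℤP.+-assoc (g x) _ _))

∑-concatMap : (f : A → List B) (xs : List A) (g : B → ℤ) →
              ∑ (concatMap f xs) g ≡ ∑ xs (λ x → ∑ (f x) g)
∑-concatMap f []       g = refl
∑-concatMap f (x ∷ xs) g =
  trans (∑-++ (f x) (concatMap f xs) g) (cong (_+_ (∑ (f x) g)) (∑-concatMap f xs g))

∑-+ : (xs : List A) (f g : A → ℤ) → ∑ xs (λ x → f x + g x) ≡ ∑ xs f + ∑ xs g
∑-+ []       f g = refl
∑-+ (x ∷ xs) f g = trans (cong (_+_ (f x + g x)) (∑-+ xs f g)) (+-interchange (f x) (g x) _ _)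
  where
  +-interchange : ∀ a b c d → a + b + (c + d) ≡ a + c + (b + d)
  +-interchange = solve-∀

∑-zero : (xs : List A) → ∑ xs (λ _ → 0ℤ) ≡ 0ℤ
∑-zero []       = refl
∑-zero (x ∷ xs) = trans (ℤP.+-identityˡ _) (∑-zero xs)

∑-swap : (xs : List A) (ys : List B) (f : A → B → ℤ) →
         ∑ xs (λ x → ∑ ys (f x)) ≡ ∑ ys (λ y → ∑ xs (λ x → f x y))
∑-swap []       ys f = sym (∑-zero ys)
∑-swap (x ∷ xs) ys f =
  trans (cong (_+_ (∑ ys (f x))) (∑-swap xs ys f)) (sym (∑-+ ys (f x) (λ y → ∑ xs (λ x → f x y))))

*-distribˡ-∑ : (a : ℤ) (xs : List A) (f : A → ℤ) → a * ∑ xs f ≡ ∑ xs (λ x → a * f x)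
*-distribˡ-∑ a []       f = ℤP.*-zeroʳ a
*-distribˡ-∑ a (x ∷ xs) f = trans (ℤP.*-distribˡ-+ a (f x) _) (cong (_+_ (a * f x)) (*-distribˡ-∑ a xs f))

∑< : ℕ → (ℕ → ℤ) → ℤ
∑< zero    g = 0ℤ
∑< (suc L) g = g 0 + ∑< L (λ r → g (suc r))

∑-applyUpTo : (f : ℕ → ℕ) (L : ℕ) (g : ℕ → ℤ) → ∑ (applyUpTo f L) g ≡ ∑< L (λ r → g (f r))
∑-applyUpTo f zero    g = refl
∑-applyUpTo f (suc L) g = cong (_+_ (g (f 0))) (∑-applyUpTo (λ r → f (suc r)) L g)

∑-upTo : (L : ℕ) (g : ℕ → ℤ) → ∑ (upTo L) g ≡ ∑< L g
∑-upTo = ∑-applyUpTo (λ r → r)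

∑<-cong : (L : ℕ) {f g : ℕ → ℤ} → (∀ r → r < L → f r ≡ g r) → ∑< L f ≡ ∑< L g
∑<-cong zero    f≗g = refl
∑<-cong (suc L) f≗g = cong₂ _+_ (f≗g 0 (s≤s z≤n)) (∑<-cong L (λ r r<L → f≗g (suc r) (s≤s r<L)))

∑<-zero : (L : ℕ) {f : ℕ → ℤ} → (∀ r → r < L → f r ≡ 0ℤ) → ∑< L f ≡ 0ℤ
∑<-zero zero    f≗0 = refl
∑<-zero (suc L) f≗0 = cong₂ _+_ (f≗0 0 (s≤s z≤n)) (∑<-zero L (λ r r<L → f≗0 (suc r) (s≤s r<L)))

∑<-split : (L M : ℕ) (f : ℕ → ℤ) → ∑< (L ℕ.+ M) f ≡ ∑< L f + ∑< M (λ r → f (L ℕ.+ r))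
∑<-split zero    M f = sym (ℤP.+-identityˡ _)
∑<-split (suc L) M f = trans (cong (_+_ (f 0)) (∑<-split L M (λ r → f (suc r)))) (sym (ℤP.+-assoc (f 0) _ _))

∑<-telescope : (L : ℕ) (G : ℕ → ℤ) → ∑< L (λ r → G r - G (suc r)) ≡ G 0 - G L
∑<-telescope zero    G = sym (ℤP.+-inverseʳ (G 0))
∑<-telescope (suc L) G =
  trans (cong (_+_ (G 0 - G 1)) (∑<-telescope L (λ r → G (suc r)))) (cancel (G 0) (G 1) (G (suc L)))
  where
  cancel : ∀ a b c → a - b + (b - c) ≡ a - c
  cancel = solve-∀

∑<-by-parts : (L : ℕ) (c g : ℕ → ℤ) →
  ∑< (suc L) (λ r → c r * (g r - g (suc r))) + c L * g (suc L)
    ≡ c 0 * g 0 + ∑< L (λ r → (c (suc r) - c r) * g (suc r))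
∑<-by-parts zero c g = regroup (c 0) (g 0) (g 1)
  where
  regroup : ∀ c₀ g₀ g₁ → c₀ * (g₀ - g₁) + 0ℤ + c₀ * g₁ ≡ c₀ * g₀ + 0ℤ
  regroup = solve-∀
∑<-by-parts (suc L) c g = begin
  c 0 * (g 0 - g 1) + T + c (suc L) * g (suc (suc L))
    ≡⟨ ℤP.+-assoc (c 0 * (g 0 - g 1)) T _ ⟩
  c 0 * (g 0 - g 1) + (T + c (suc L) * g (suc (suc L)))
    ≡⟨ cong (_+_ (c 0 * (g 0 - g 1))) (∑<-by-parts L (λ r → c (suc r)) (λ r → g (suc r))) ⟩
  c 0 * (g 0 - g 1) + (c 1 * g 1 + S)
    ≡⟨ regroup (c 0) (c 1) (g 0) (g 1) S ⟩
  c 0 * g 0 + ((c 1 - c 0) * g 1 + S) ∎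
  where
  open ≡-Reasoning
  T S : ℤ
  T = ∑< (suc L) (λ r → c (suc r) * (g (suc r) - g (suc (suc r))))
  S = ∑< L (λ r → (c (suc (suc r)) - c (suc r)) * g (suc (suc r)))
  regroup : ∀ c₀ c₁ g₀ g₁ s → c₀ * (g₀ - g₁) + (c₁ * g₁ + s) ≡ c₀ * g₀ + ((c₁ - c₀) * g₁ + s)
  regroup = solve-∀

*-distribˡ-minus : ∀ a x y → a * (x - y) ≡ a * x - a * y
*-distribˡ-minus = solve-∀

∇ : ℤ → (ℤ → ℤ) → ℤ → ℤ
∇ s f t = f t - f (t - s)

∇^ : ℤ → ℕ → (ℤ → ℤ) → ℤ → ℤ
∇^ s zero    f = f
∇^ s (suc N) f = ∇^ s N (∇ s f)

∇^-cong : ∀ s N {f g : ℤ → ℤ} → (∀ t → f t ≡ g t) → ∀ t → ∇^ s N f t ≡ ∇^ s N g t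
∇^-cong s zero    f≗g = f≗g
∇^-cong s (suc N) f≗g = ∇^-cong s N (λ u → cong₂ _-_ (f≗g u) (f≗g (u - s)))

∇^-+ : ∀ s N (f g : ℤ → ℤ) t → ∇^ s N (λ u → f u + g u) t ≡ ∇^ s N f t + ∇^ s N g t
∇^-+ s zero    f g t = refl
∇^-+ s (suc N) f g t =
  trans (∇^-cong s N (λ u → interchange (f u) (g u) (f (u - s)) (g (u - s))) t) (∇^-+ s N (∇ s f) (∇ s g) t)
  where
  interchange : ∀ a b c d → a + b - (c + d) ≡ (a - c) + (b - d)
  interchange = solve-∀

∇^-*ˡ : ∀ s N (α : ℤ) (f : ℤ → ℤ) t → ∇^ s N (λ u → α * f u) t ≡ α * ∇^ s N f t
∇^-*ˡ s zero    α f t = refl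
∇^-*ˡ s (suc N) α f t =
  trans (∇^-cong s N (λ u → sym (*-distribˡ-minus α (f u) (f (u - s)))) t) (∇^-*ˡ s N α (∇ s f) t)

∇^-translate : ∀ s N (e : ℤ) (f : ℤ → ℤ) t → ∇^ s N (λ u → f (u + e)) t ≡ ∇^ s N f (t + e)
∇^-translate s zero    e f t = refl
∇^-translate s (suc N) e f t =
  trans (∇^-cong s N (λ u → cong (λ x → f (u + e) - f x) (swap u s e)) t) (∇^-translate s N e (∇ s f) t)
  where
  swap : ∀ u s e → u - s + e ≡ u + e - s
  swap = solve-∀

∇^-∇-comm : ∀ s N (e : ℤ) (f : ℤ → ℤ) t → ∇^ s N (∇ e f) t ≡ ∇ e (∇^ s N f) t
∇^-∇-comm s zero    e f t = refl
∇^-∇-comm s (suc N) e f t =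
  trans (∇^-cong s N (λ u → trans (interchange (f u) (f (u - e)) (f (u - s)) _)
                                  (cong (λ x → ∇ s f u - (f (u - e) - f x)) (swap u e s))) t)
        (∇^-∇-comm s N e (∇ s f) t)
  where
  interchange : ∀ a b c d → a - b - (c - d) ≡ a - c - (b - d)
  interchange = solve-∀
  swap : ∀ u e s → u - s - e ≡ u - e - s
  swap = solve-∀

∇^-rescale : ∀ N (s e α : ℤ) (f g : ℤ → ℤ) → (∀ u → f (u * s + e) ≡ α * g u) →
             ∀ u → ∇^ s N f (u * s + e) ≡ α * ∇^ 1ℤ N g u
∇^-rescale zero    s e α f g f≗αg = f≗αg
∇^-rescale (suc N) s e α f g f≗αg = ∇^-rescale N s e α (∇ s f) (∇ 1ℤ g) ∇f≗α∇g
  where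
  step-back : ∀ u s e → u * s + e - s ≡ (u - 1ℤ) * s + e
  step-back = solve-∀
  ∇f≗α∇g : ∀ u → ∇ s f (u * s + e) ≡ α * ∇ 1ℤ g u
  ∇f≗α∇g u = trans (cong₂ _-_ (f≗αg u) (trans (cong f (step-back u s e)) (f≗αg (u - 1ℤ))))
                   (sym (*-distribˡ-minus α (g u) (g (u - 1ℤ))))

signedBinomial : ℕ → ℕ → ℤ
signedBinomial N r = sign r * + (N C r)

signedBinomial-pascal : ∀ N r →
  signedBinomial (suc N) (suc r) ≡ signedBinomial N (suc r) - signedBinomial N r
signedBinomial-pascal N r = begin
  - 1ℤ * sign r * + (suc N C suc r)
    ≡⟨ cong (λ x → - 1ℤ * sign r * + x) (sym (nCk+nC[k+1]≡[n+1]C[k+1] N r)) ⟩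
  - 1ℤ * sign r * + (N C r ℕ.+ N C suc r)
    ≡⟨ cong (- 1ℤ * sign r *_) (ℤP.pos-+ (N C r) (N C suc r)) ⟩
  - 1ℤ * sign r * (+ (N C r) + + (N C suc r))
    ≡⟨ expand (sign r) (+ (N C r)) (+ (N C suc r)) ⟩
  - 1ℤ * sign r * + (N C suc r) - sign r * + (N C r) ∎
  where
  open ≡-Reasoning
  expand : ∀ σ a b → - 1ℤ * σ * (a + b) ≡ - 1ℤ * σ * b - σ * a
  expand = solve-∀

∇^-binomial : ∀ N L → N < L → ∀ f t → ∇^ 1ℤ N f t ≡ ∑< L (λ r → signedBinomial N r * f (t - + r))
∇^-binomial zero (suc L) _ f t = sym (begin
  1ℤ * f (t - + 0) + ∑< L (λ r → signedBinomial 0 (suc r) * f (t - + suc r))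
    ≡⟨ cong₂ _+_ (ℤP.*-identityˡ (f (t - + 0))) (∑<-zero L (λ r _ → cong (_* f (t - + suc r)) (vanishes r))) ⟩
  f (t - + 0) + 0ℤ
    ≡⟨ trans (ℤP.+-identityʳ _) (cong f (ℤP.+-identityʳ t)) ⟩
  f t ∎)
  where
  open ≡-Reasoning
  vanishes : ∀ r → signedBinomial 0 (suc r) ≡ 0ℤ
  vanishes r =
    trans (cong (λ x → sign (suc r) * + x) (k>n⇒nCk≡0 {0} {suc r} (s≤s z≤n))) (ℤP.*-zeroʳ (sign (suc r)))
∇^-binomial (suc N) (suc L) (s≤s N<L) f t = begin
  ∇^ 1ℤ N (∇ 1ℤ f) t
    ≡⟨ ∇^-binomial N (suc L) (ℕP.m<n⇒m<1+n N<L) (∇ 1ℤ f) t ⟩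
  ∑< (suc L) (λ r → c r * ∇ 1ℤ f (t - + r))
    ≡⟨ ∑<-cong (suc L) (λ r _ → cong (λ x → c r * (g r - f x)) (step-back t (+ r))) ⟩
  ∑< (suc L) (λ r → c r * (g r - g (suc r)))
    ≡⟨ sym (ℤP.+-identityʳ _) ⟩
  ∑< (suc L) (λ r → c r * (g r - g (suc r))) + 0ℤ * g (suc L)
    ≡⟨ cong (λ x → ∑< (suc L) (λ r → c r * (g r - g (suc r))) + x * g (suc L)) (sym c[L]≡0) ⟩
  ∑< (suc L) (λ r → c r * (g r - g (suc r))) + c L * g (suc L)
    ≡⟨ ∑<-by-parts L c g ⟩
  c 0 * g 0 + ∑< L (λ r → (c (suc r) - c r) * g (suc r))
    ≡⟨ cong (_+_ (c 0 * g 0)) (∑<-cong L (λ r _ → cong (_* g (suc r)) (sym (signedBinomial-pascal N r)))) ⟩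
  ∑< (suc L) (λ r → signedBinomial (suc N) r * g r) ∎
  where
  open ≡-Reasoning
  c : ℕ → ℤ
  c = signedBinomial N
  g : ℕ → ℤ
  g r = f (t - + r)
  step-back : ∀ t r → t - r - 1ℤ ≡ t - (1ℤ + r)
  step-back = solve-∀
  c[L]≡0 : c L ≡ 0ℤ
  c[L]≡0 = trans (cong (λ x → sign L * + x) (k>n⇒nCk≡0 N<L)) (ℤP.*-zeroʳ (sign L))

DegreeBelow : ℕ → (ℤ → ℤ) → Set
DegreeBelow N f = ∀ t → ∇^ 1ℤ N f t ≡ 0ℤ

degreeBelow-suc : ∀ N f → DegreeBelow N f → DegreeBelow (suc N) f
degreeBelow-suc N f deg t = trans (∇^-∇-comm 1ℤ N 1ℤ f t) (cong₂ _-_ (deg t) (deg (t - 1ℤ)))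

degreeBelow-mono : ∀ {N M} f → N ≤ M → DegreeBelow N f → DegreeBelow M f
degreeBelow-mono f N≤M = go (ℕP.≤⇒≤′ N≤M)
  where
  go : ∀ {N M} → N ℕ.≤′ M → DegreeBelow N f → DegreeBelow M f
  go ℕ.≤′-refl            deg = deg
  go (ℕ.≤′-step {M} N≤′M) deg = degreeBelow-suc M f (go N≤′M deg)

degreeBelow-*-linear : ∀ α c N f → DegreeBelow N f → DegreeBelow (suc N) (λ u → (α * u + c) * f u)
degreeBelow-*-linear α c zero f deg t = begin
  (α * t + c) * f t - (α * (t - 1ℤ) + c) * f (t - 1ℤ)
    ≡⟨ cong₂ (λ x y → (α * t + c) * x - (α * (t - 1ℤ) + c) * y) (deg t) (deg (t - 1ℤ)) ⟩
  (α * t + c) * 0ℤ - (α * (t - 1ℤ) + c) * 0ℤ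
    ≡⟨ annihilate α c t ⟩
  0ℤ ∎
  where
  open ≡-Reasoning
  annihilate : ∀ α c t → (α * t + c) * 0ℤ - (α * (t - 1ℤ) + c) * 0ℤ ≡ 0ℤ
  annihilate = solve-∀
degreeBelow-*-linear α c (suc N) f deg t = begin
  ∇^ 1ℤ (suc N) (∇ 1ℤ (λ u → (α * u + c) * f u)) t
    ≡⟨ ∇^-cong 1ℤ (suc N) (λ u → product-rule α c u (f u) (f (u - 1ℤ))) t ⟩
  ∇^ 1ℤ (suc N) (λ u → (α * u + c) * ∇ 1ℤ f u + α * f (u - 1ℤ)) t
    ≡⟨ ∇^-+ 1ℤ (suc N) (λ u → (α * u + c) * ∇ 1ℤ f u) (λ u → α * f (u - 1ℤ)) t ⟩
  ∇^ 1ℤ (suc N) (λ u → (α * u + c) * ∇ 1ℤ f u) t + ∇^ 1ℤ (suc N) (λ u → α * f (u - 1ℤ)) t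
    ≡⟨ cong₂ _+_ (degreeBelow-*-linear α c N (∇ 1ℤ f) deg t)
                 (trans (∇^-*ˡ 1ℤ (suc N) α (λ u → f (u - 1ℤ)) t)
                        (cong (α *_) (trans (∇^-translate 1ℤ (suc N) (- 1ℤ) f t) (deg (t - 1ℤ))))) ⟩
  0ℤ + α * 0ℤ
    ≡⟨ trans (ℤP.+-identityˡ _) (ℤP.*-zeroʳ α) ⟩
  0ℤ ∎
  where
  open ≡-Reasoning
  product-rule : ∀ α c u x y → (α * u + c) * x - (α * (u - 1ℤ) + c) * y ≡ (α * u + c) * (x - y) + α * y
  product-rule = solve-∀

degreeBelow-^ : ∀ α c p → DegreeBelow (suc p) (λ u → (α * u + c) ℤ.^ p)
degreeBelow-^ α c zero    t = refl
degreeBelow-^ α c (suc p) =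
  degreeBelow-*-linear α c (suc p) (λ u → (α * u + c) ℤ.^ p) (degreeBelow-^ α c p)

𝟙 : Dec P → ℤ
𝟙 (yes _) = 1ℤ
𝟙 (no _)  = 0ℤ

𝟙-cong : (p : Dec P) (q : Dec Q) → (P → Q) → (Q → P) → 𝟙 p ≡ 𝟙 q
𝟙-cong (yes _) (yes _) _   _   = refl
𝟙-cong (yes p) (no ¬q) p→q _   = ⊥-elim (¬q (p→q p))
𝟙-cong (no ¬p) (yes q) _   q→p = ⊥-elim (¬p (q→p q))
𝟙-cong (no _)  (no _)  _   _   = refl

𝟙-yes : (p : Dec P) → P → 𝟙 p ≡ 1ℤ
𝟙-yes (yes _) _ = refl
𝟙-yes (no ¬p) p = ⊥-elim (¬p p)

𝟙-no : (p : Dec P) → ¬ P → 𝟙 p ≡ 0ℤ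
𝟙-no (yes p) ¬p = ⊥-elim (¬p p)
𝟙-no (no _)  _  = refl

length-filter : {R : A → Set} (R? : ∀ x → Dec (R x)) (xs : List A) →
                + length (filter R? xs) ≡ ∑ xs (λ x → 𝟙 (R? x))
length-filter R? []       = refl
length-filter R? (x ∷ xs) with R? x
... | yes _ = cong (_+_ 1ℤ) (length-filter R? xs)
... | no _  = trans (length-filter R? xs) (sym (ℤP.+-identityˡ _))

δ : ℤ → ℤ → ℤ
δ x y = 𝟙 (x ℤ.≟ y)

*-δ-≢ : ∀ g x y → x ≢ y → g * δ x y ≡ 0ℤ
*-δ-≢ g x y x≢y = trans (cong (g *_) (𝟙-no (x ℤ.≟ y) x≢y)) (ℤP.*-zeroʳ g)

∑<-δ-miss : ∀ L (G : ℕ → ℤ) u → (∀ r → r < L → + r ≢ u) → ∑< L (λ r → G r * δ (+ r) u) ≡ 0ℤ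
∑<-δ-miss L G u miss = ∑<-zero L (λ r r<L → *-δ-≢ (G r) (+ r) u (miss r r<L))

∑<-δ-hit : ∀ L (G : ℕ → ℤ) a → a < L → ∑< L (λ r → G r * δ (+ r) (+ a)) ≡ G a
∑<-δ-hit (suc L) G zero _ =
  trans (cong₂ _+_ (ℤP.*-identityʳ (G 0)) (∑<-zero L (λ r _ → *-δ-≢ (G (suc r)) (+ suc r) 0ℤ (λ ()))))
        (ℤP.+-identityʳ (G 0))
∑<-δ-hit (suc L) G (suc a) (s≤s a<L) = begin
  G 0 * δ 0ℤ (+ suc a) + ∑< L (λ r → G (suc r) * δ (+ suc r) (+ suc a))
    ≡⟨ cong₂ _+_ (*-δ-≢ (G 0) 0ℤ (+ suc a) (λ ()))
                 (∑<-cong L (λ r _ → cong (G (suc r) *_) (𝟙-cong (+ suc r ℤ.≟ + suc a) (+ r ℤ.≟ + a)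
                                                                 (cong ℤ.pred) (cong ℤ.suc)))) ⟩
  0ℤ + ∑< L (λ r → G (suc r) * δ (+ r) (+ a))
    ≡⟨ trans (ℤP.+-identityˡ _) (∑<-δ-hit L (λ r → G (suc r)) a a<L) ⟩
  G (suc a) ∎
  where open ≡-Reasoning

≤-by-difference : ∀ a b c d → b - a ≡ d - c → a ℤ.≤ b → c ℤ.≤ d
≤-by-difference _ _ _ _ eq a≤b = ℤP.0≤i-j⇒j≤i (subst (0ℤ ℤ.≤_) eq (ℤP.i≤j⇒0≤j-i a≤b))

Balanced : ℕ → ℤ → Set
Balanced H t = - + H ℤ.≤ t × t ℤ.≤ + H

balanced? : ∀ H t → Dec (Balanced H t)
balanced? H t = (- + H ℤ.≤? t) ×-dec (t ℤ.≤? + H)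

extendByZero : ℕ → (ℤ → ℤ) → ℤ → ℤ
extendByZero H w t = w t * 𝟙 (balanced? H t)

extendByZero-balanced : ∀ H w t → Balanced H t → extendByZero H w t ≡ w t
extendByZero-balanced H w t b = trans (cong (w t *_) (𝟙-yes (balanced? H t) b)) (ℤP.*-identityʳ (w t))

extendByZero-unbalanced : ∀ H w t → ¬ Balanced H t → extendByZero H w t ≡ 0ℤ
extendByZero-unbalanced H w t ¬b = trans (cong (w t *_) (𝟙-no (balanced? H t) ¬b)) (ℤP.*-zeroʳ (w t))

data Offset (H : ℕ) (t : ℤ) : Set where
  below  : ∀ {a} → t + + H ≡ -[1+ a ] → Offset H t
  inside : ∀ {a} → a ≤ 2 ℕ.* H → t + + H ≡ + a → Offset H t
  above  : ∀ {a} → 2 ℕ.* H < a → t + + H ≡ + a → Offset H t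

offset : ∀ H t → Offset H t
offset H t with t + + H in eq
... | -[1+ a ] = below eq
... | + a with a ℕ.≤? 2 ℕ.* H
...   | yes a≤2H = inside a≤2H eq
...   | no  a≰2H = above (ℕP.≰⇒> a≰2H) eq

module _ (H : ℕ) (t : ℤ) {x : ℤ} (t+H≡x : t + + H ≡ x) where

  lower-gap : t - - + H ≡ x - 0ℤ
  lower-gap = trans (shift t (+ H)) (cong (_- 0ℤ) t+H≡x)
    where
    shift : ∀ t h → t - - h ≡ t + h - 0ℤ
    shift = solve-∀

  upper-gap : + (2 ℕ.* H) - x ≡ + H - t
  upper-gap = trans (cong₂ _-_ (ℤP.pos-* 2 H) (sym t+H≡x)) (shift t (+ H))
    where
    shift : ∀ t h → + 2 * h - (t + h) ≡ h - t
    shift = solve-∀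

inside⇒balanced : ∀ {H t a} → a ≤ 2 ℕ.* H → t + + H ≡ + a → Balanced H t
inside⇒balanced {H} {t} {a} a≤2H eq =
  ≤-by-difference 0ℤ (+ a) (- + H) t (sym (lower-gap H t eq)) (ℤ.+≤+ z≤n) ,
  ≤-by-difference (+ a) (+ (2 ℕ.* H)) t (+ H) (upper-gap H t eq) (ℤ.+≤+ a≤2H)

below⇒unbalanced : ∀ {H t a} → t + + H ≡ -[1+ a ] → ¬ Balanced H t
below⇒unbalanced {H} {t} {a} eq (lo , _) with ≤-by-difference (- + H) t 0ℤ -[1+ a ] (lower-gap H t eq) lo
... | ()

above⇒unbalanced : ∀ {H t a} → 2 ℕ.* H < a → t + + H ≡ + a → ¬ Balanced H t
above⇒unbalanced {H} {t} {a} 2H<a eq (_ , hi) =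
  ℕP.<⇒≱ 2H<a (ℤP.drop‿+≤+ (≤-by-difference t (+ H) (+ a) (+ (2 ℕ.* H)) (sym (upper-gap H t eq)) hi))

∑-balancedRange : ∀ H (g : ℤ → ℤ) → ∑ (balancedRange H) g ≡ ∑< (suc (2 ℕ.* H)) (λ r → g (+ r - + H))
∑-balancedRange H g = begin
  ∑ (balancedRange H) g                       ≡⟨ ∑-map (λ r → + r - + H) (upTo (2 ℕ.* H ℕ.+ 1)) g ⟩
  ∑ (upTo (2 ℕ.* H ℕ.+ 1)) G                  ≡⟨ cong (λ L → ∑ (upTo L) G) (ℕP.+-comm (2 ℕ.* H) 1) ⟩
  ∑ (upTo (suc (2 ℕ.* H))) G                  ≡⟨ ∑-upTo (suc (2 ℕ.* H)) G ⟩
  ∑< (suc (2 ℕ.* H)) G                        ∎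
  where
  open ≡-Reasoning
  G : ℕ → ℤ
  G r = g (+ r - + H)

∑-balancedRange-δ : ∀ H (g : ℤ → ℤ) t → ∑ (balancedRange H) (λ x → g x * δ x t) ≡ extendByZero H g t
∑-balancedRange-δ H g t = begin
  ∑ (balancedRange H) (λ x → g x * δ x t)
    ≡⟨ ∑-balancedRange H (λ x → g x * δ x t) ⟩
  ∑< L (λ r → G r * δ (+ r - + H) t)
    ≡⟨ ∑<-cong L (λ r _ → cong (G r *_) (δ-recentre (+ r))) ⟩
  ∑< L (λ r → G r * δ (+ r) (t + + H))
    ≡⟨ count (offset H t) ⟩
  extendByZero H g t ∎
  where
  open ≡-Reasoning
  L : ℕ
  L = suc (2 ℕ.* H)
  G : ℕ → ℤ
  G r = g (+ r - + H)
  cancel : ∀ x h → x - h + h ≡ x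
  cancel = solve-∀
  cancel′ : ∀ x h → x + h - h ≡ x
  cancel′ = solve-∀
  δ-recentre : ∀ x → δ (x - + H) t ≡ δ x (t + + H)
  δ-recentre x = 𝟙-cong (x - + H ℤ.≟ t) (x ℤ.≟ t + + H)
    (λ eq → trans (sym (cancel x (+ H))) (cong (_+ + H) eq)) (λ eq → trans (cong (_- + H) eq) (cancel′ t (+ H)))
  count : Offset H t → ∑< L (λ r → G r * δ (+ r) (t + + H)) ≡ extendByZero H g t
  count (below eq) = begin
    ∑< L (λ r → G r * δ (+ r) (t + + H)) ≡⟨ ∑<-δ-miss L G (t + + H) (λ _ _ r≡ → +≢-[1+] (trans r≡ eq)) ⟩
    0ℤ                                   ≡⟨ sym (extendByZero-unbalanced H g t (below⇒unbalanced eq)) ⟩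
    extendByZero H g t                   ∎
    where
    +≢-[1+] : ∀ {r a} → + r ≢ -[1+ a ]
    +≢-[1+] ()
  count (inside {a} a≤2H eq) = begin
    ∑< L (λ r → G r * δ (+ r) (t + + H)) ≡⟨ cong (λ u → ∑< L (λ r → G r * δ (+ r) u)) eq ⟩
    ∑< L (λ r → G r * δ (+ r) (+ a))     ≡⟨ ∑<-δ-hit L G a (s≤s a≤2H) ⟩
    g (+ a - + H)                        ≡⟨ cong g (trans (cong (_- + H) (sym eq)) (cancel′ t (+ H))) ⟩
    g t                                  ≡⟨ sym (extendByZero-balanced H g t (inside⇒balanced a≤2H eq)) ⟩
    extendByZero H g t                   ∎
  count (above {a} 2H<a eq) = begin
    ∑< L (λ r → G r * δ (+ r) (t + + H)) ≡⟨ ∑<-δ-miss L G (t + + H) (λ r r<L r≡ → beyond r<L (trans r≡ eq)) ⟩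
    0ℤ                                   ≡⟨ sym (extendByZero-unbalanced H g t (above⇒unbalanced 2H<a eq)) ⟩
    extendByZero H g t                   ∎
    where
    beyond : ∀ {r} → r < L → + r ≢ + a
    beyond r<L r≡a = ℕP.<⇒≱ 2H<a (subst (_≤ 2 ℕ.* H) (ℤP.+-injective r≡a) (ℕP.m<1+n⇒m≤n r<L))

half-odd : ∀ h → half (2 ℕ.* h ℕ.+ 1) ≡ h
half-odd h = begin
  (2 ℕ.* h ℕ.+ 1 ∸ 1) ℕ./ 2 ≡⟨ cong (ℕ._/ 2) (trans (ℕP.m+n∸n≡m (2 ℕ.* h) 1) (ℕP.*-comm 2 h)) ⟩
  (h ℕ.* 2) ℕ./ 2           ≡⟨ ℕD.m*n/n≡m h 2 ⟩
  h                         ∎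
  where open ≡-Reasoning

∑-tuples-suc : ∀ b n (F : List ℤ → ℤ) →
               ∑ (tuples b (suc n)) F ≡ ∑ (digits b) (λ d → ∑ (tuples b n) (λ xs → F (d ∷ xs)))
∑-tuples-suc b n F = trans (∑-concatMap (λ d → map (d ∷_) (tuples b n)) (digits b) F)
                           (∑-cong (digits b) (λ d → ∑-map (d ∷_) (tuples b n) F))

module OddBase (h : ℕ) where

  b : ℕ
  b = 2 ℕ.* h ℕ.+ 1

  digits≡balancedRange : digits b ≡ balancedRange h
  digits≡balancedRange = cong balancedRange (half-odd h)

  ∑-digits-∇ : ∀ F c → ∑ (digits b) (λ d → ∇ 1ℤ F (c - d)) ≡ ∇ (+ b) F (c + + h)
  ∑-digits-∇ F c = begin
    ∑ (digits b) (λ d → ∇ 1ℤ F (c - d))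
      ≡⟨ cong (λ D → ∑ D (λ d → ∇ 1ℤ F (c - d))) digits≡balancedRange ⟩
    ∑ (balancedRange h) (λ d → ∇ 1ℤ F (c - d))
      ≡⟨ ∑-balancedRange h (λ d → ∇ 1ℤ F (c - d)) ⟩
    ∑< (suc (2 ℕ.* h)) (λ r → ∇ 1ℤ F (c - (+ r - + h)))
      ≡⟨ ∑<-cong (suc (2 ℕ.* h)) (λ r _ →
           cong₂ (λ x y → F x - F y) (recentre c (+ r) (+ h)) (recentre-suc c (+ r) (+ h))) ⟩
    ∑< (suc (2 ℕ.* h)) (λ r → G r - G (suc r))
      ≡⟨ ∑<-telescope (suc (2 ℕ.* h)) G ⟩
    G 0 - G (suc (2 ℕ.* h))
      ≡⟨ cong₂ (λ x y → F x - F (c + + h - + y)) (ℤP.+-identityʳ (c + + h)) (ℕP.+-comm 1 (2 ℕ.* h)) ⟩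
    ∇ (+ b) F (c + + h) ∎
    where
    open ≡-Reasoning
    G : ℕ → ℤ
    G r = F (c + + h - + r)
    recentre : ∀ c r h → c - (r - h) ≡ c + h - r
    recentre = solve-∀
    recentre-suc : ∀ c r h → c - (r - h) - 1ℤ ≡ c + h - (1ℤ + r)
    recentre-suc = solve-∀

  ∑-tuples-∇^ : ∀ N f c →
    ∑ (tuples b N) (λ xs → ∇^ 1ℤ N f (c - sumℤ xs)) ≡ ∇^ (+ b) N f (c + + N * + h)
  ∑-tuples-∇^ zero f c = trans (ℤP.+-identityʳ _) (cong f (shift c (+ h)))
    where
    shift : ∀ c h → c - 0ℤ ≡ c + 0ℤ * h
    shift = solve-∀
  ∑-tuples-∇^ (suc N) f c = begin
    ∑ (tuples b (suc N)) (λ ys → ∇^ 1ℤ N (∇ 1ℤ f) (c - sumℤ ys))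
      ≡⟨ ∑-tuples-suc b N (λ ys → ∇^ 1ℤ N (∇ 1ℤ f) (c - sumℤ ys)) ⟩
    ∑ (digits b) (λ d → ∑ (tuples b N) (λ xs → ∇^ 1ℤ N (∇ 1ℤ f) (c - (d + sumℤ xs))))
      ≡⟨ ∑-cong (digits b) (λ d → ∑-cong (tuples b N) (λ xs →
           cong (∇^ 1ℤ N (∇ 1ℤ f)) (regroup c d (sumℤ xs)))) ⟩
    ∑ (digits b) (λ d → ∑ (tuples b N) (λ xs → ∇^ 1ℤ N (∇ 1ℤ f) (c - d - sumℤ xs)))
      ≡⟨ ∑-cong (digits b) (λ d → ∑-tuples-∇^ N (∇ 1ℤ f) (c - d)) ⟩
    ∑ (digits b) (λ d → ∇^ (+ b) N (∇ 1ℤ f) (c - d + + N * + h))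
      ≡⟨ ∑-cong (digits b) (λ d →
           trans (∇^-∇-comm (+ b) N 1ℤ f _) (cong (∇ 1ℤ F) (swap c d (+ N * + h)))) ⟩
    ∑ (digits b) (λ d → ∇ 1ℤ F (c + + N * + h - d))
      ≡⟨ ∑-digits-∇ F (c + + N * + h) ⟩
    ∇ (+ b) F (c + + N * + h + + h)
      ≡⟨ sym (∇^-∇-comm (+ b) N (+ b) f _) ⟩
    ∇^ (+ b) (suc N) f (c + + N * + h + + h)
      ≡⟨ cong (∇^ (+ b) (suc N) f) (absorb c (+ N) (+ h)) ⟩
    ∇^ (+ b) (suc N) f (c + + suc N * + h) ∎
    where
    open ≡-Reasoning
    F : ℤ → ℤ
    F = ∇^ (+ b) N f
    regroup : ∀ c d s → c - (d + s) ≡ c - d - s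
    regroup = solve-∀
    swap : ∀ c d e → c - d + e ≡ c + e - d
    swap = solve-∀
    absorb : ∀ c n h → c + n * h + h ≡ c + (1ℤ + n) * h
    absorb = solve-∀

  private
    lower : ∀ c s i h → c + h - (i + s) ≡ c - s - i - - h
    lower = solve-∀
    upper : ∀ c s i h → i + s - (c - h) ≡ h - (c - s - i)
    upper = solve-∀

  carryOut→balanced : ∀ i xs k → CarryOut b i xs k → Balanced h (k * + b - sumℤ xs - i)
  carryOut→balanced i xs k rewrite half-odd h = λ (lo , hi) →
    ≤-by-difference (i + s) (c + + h) (- + h) (c - s - i) (lower c s i (+ h)) hi ,
    ≤-by-difference (c - + h) (i + s) (c - s - i) (+ h) (upper c s i (+ h)) lo
    where
    c s : ℤ
    c = k * + b
    s = sumℤ xs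

  balanced→carryOut : ∀ i xs k → Balanced h (k * + b - sumℤ xs - i) → CarryOut b i xs k
  balanced→carryOut i xs k rewrite half-odd h = λ (lo , hi) →
    ≤-by-difference (c - s - i) (+ h) (c - + h) (i + s) (sym (upper c s i (+ h))) hi ,
    ≤-by-difference (- + h) (c - s - i) (i + s) (c + + h) (sym (lower c s i (+ h))) lo
    where
    c s : ℤ
    c = k * + b
    s = sumℤ xs

  carryIndicator : ∀ i xs k →
    𝟙 (carryOut? b i k xs) ≡ ∑ (digits b) (λ d → δ i (k * + b - sumℤ xs - d))
  carryIndicator i xs k = sym (begin
    ∑ (digits b) (λ d → δ i (c - d))
      ≡⟨ cong (λ D → ∑ D (λ d → δ i (c - d))) digits≡balancedRange ⟩
    ∑ (balancedRange h) (λ d → δ i (c - d))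
      ≡⟨ ∑-cong (balancedRange h) (λ d →
           trans (𝟙-cong (i ℤ.≟ c - d) (d ℤ.≟ c - i) (exchange i d) (exchange d i)) (sym (ℤP.*-identityˡ _))) ⟩
    ∑ (balancedRange h) (λ d → 1ℤ * δ d (c - i))
      ≡⟨ ∑-balancedRange-δ h (λ _ → 1ℤ) (c - i) ⟩
    1ℤ * 𝟙 (balanced? h (c - i))
      ≡⟨ ℤP.*-identityˡ _ ⟩
    𝟙 (balanced? h (c - i))
      ≡⟨ 𝟙-cong (balanced? h (c - i)) (carryOut? b i k xs)
                (balanced→carryOut i xs k) (carryOut→balanced i xs k) ⟩
    𝟙 (carryOut? b i k xs) ∎)
    where
    open ≡-Reasoning
    c : ℤ
    c = k * + b - sumℤ xs
    exchange : ∀ u v → u ≡ c - v → v ≡ c - u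
    exchange u v u≡c-v = trans (sym (involutive c v)) (cong (_-_ c) (sym u≡c-v))
      where
      involutive : ∀ c v → c - (c - v) ≡ v
      involutive = solve-∀

  ∑-carryOut : ∀ m (w : ℤ → ℤ) k xs →
    ∑ (states m) (λ i → w i * 𝟙 (carryOut? b i k xs))
      ≡ ∑ (digits b) (λ d → extendByZero m w (k * + b - sumℤ xs - d))
  ∑-carryOut m w k xs = begin
    ∑ (states m) (λ i → w i * 𝟙 (carryOut? b i k xs))
      ≡⟨ ∑-cong (states m) (λ i →
           trans (cong (w i *_) (carryIndicator i xs k)) (*-distribˡ-∑ (w i) (digits b) _)) ⟩
    ∑ (states m) (λ i → ∑ (digits b) (λ d → w i * δ i (c - d)))
      ≡⟨ ∑-swap (states m) (digits b) (λ i d → w i * δ i (c - d)) ⟩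
    ∑ (digits b) (λ d → ∑ (states m) (λ i → w i * δ i (c - d)))
      ≡⟨ ∑-cong (digits b) (λ d → ∑-balancedRange-δ m w (c - d)) ⟩
    ∑ (digits b) (λ d → extendByZero m w (c - d)) ∎
    where
    open ≡-Reasoning
    c : ℤ
    c = k * + b - sumℤ xs

  ∑-carryCount : ∀ m n (w : ℤ → ℤ) k →
    ∑ (states m) (λ i → w i * + carryCount b n i k)
      ≡ ∑ (tuples b (suc n)) (λ ys → extendByZero m w (k * + b - sumℤ ys))
  ∑-carryCount m n w k = begin
    ∑ (states m) (λ i → w i * + carryCount b n i k)
      ≡⟨ ∑-cong (states m) (λ i → trans (cong (w i *_) (length-filter (carryOut? b i k) (tuples b n)))
                                         (*-distribˡ-∑ (w i) (tuples b n) _)) ⟩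
    ∑ (states m) (λ i → ∑ (tuples b n) (λ xs → w i * 𝟙 (carryOut? b i k xs)))
      ≡⟨ ∑-swap (states m) (tuples b n) (λ i xs → w i * 𝟙 (carryOut? b i k xs)) ⟩
    ∑ (tuples b n) (λ xs → ∑ (states m) (λ i → w i * 𝟙 (carryOut? b i k xs)))
      ≡⟨ ∑-cong (tuples b n) (∑-carryOut m w k) ⟩
    ∑ (tuples b n) (λ xs → ∑ (digits b) (λ d → extendByZero m w (k * + b - sumℤ xs - d)))
      ≡⟨ ∑-swap (tuples b n) (digits b) (λ xs d → extendByZero m w (k * + b - sumℤ xs - d)) ⟩
    ∑ (digits b) (λ d → ∑ (tuples b n) (λ xs → extendByZero m w (k * + b - sumℤ xs - d)))
      ≡⟨ ∑-cong (digits b) (λ d → ∑-cong (tuples b n) (λ xs →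
           cong (extendByZero m w) (regroup (k * + b) (sumℤ xs) d))) ⟩
    ∑ (digits b) (λ d → ∑ (tuples b n) (λ xs → extendByZero m w (k * + b - sumℤ (d ∷ xs))))
      ≡⟨ sym (∑-tuples-suc b n (λ ys → extendByZero m w (k * + b - sumℤ ys))) ⟩
    ∑ (tuples b (suc n)) (λ ys → extendByZero m w (k * + b - sumℤ ys)) ∎
    where
    open ≡-Reasoning
    regroup : ∀ c s d → c - s - d ≡ c - (d + s)
    regroup = solve-∀

^-distribʳ-* : ∀ x y p → (x * y) ℤ.^ p ≡ x ℤ.^ p * y ℤ.^ p
^-distribʳ-* x y zero    = refl
^-distribʳ-* x y (suc p) = trans (cong (x * y *_) (^-distribʳ-* x y p)) (interchange x y (x ℤ.^ p) (y ℤ.^ p))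
  where
  interchange : ∀ x y a b → x * y * (a * b) ≡ x * a * (y * b)
  interchange = solve-∀

+-∸ : ∀ {a r} → r ≤ a → + a - + r ≡ + (a ∸ r)
+-∸ {a} {r} r≤a = trans (ℤP.m-n≡m⊖n a r) (ℤP.⊖-≥ r≤a)

+-overshoot : ∀ a r → + a - + (suc a ℕ.+ r) ≡ -[1+ r ]
+-overshoot a r = trans (cong (_-_ (+ a)) (ℤP.pos-+ (suc a) r)) (cancel (+ a) (+ r))
  where
  cancel : ∀ x y → x - (1ℤ + x + y) ≡ - (1ℤ + y)
  cancel = solve-∀

-[1+]-+ : ∀ a r → -[1+ a ] - + r ≡ -[1+ a ℕ.+ r ]
-[1+]-+ a r = trans (sym (ℤP.neg-distrib-+ (+ suc a) (+ r))) (cong -_ (sym (ℤP.pos-+ (suc a) r)))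

odd-+ : ∀ c → + 2 * + c + 1ℤ ≡ +[1+ 2 ℕ.* c ]
odd-+ c = trans (ℤP.+-comm (+ 2 * + c) 1ℤ) (cong (_+_ 1ℤ) (sym (ℤP.pos-* 2 c)))

odd--[1+] : ∀ c → + 2 * -[1+ c ] + 1ℤ ≡ -[1+ 2 ℕ.* c ]
odd--[1+] c = trans (negate (+ c)) (cong -_ (odd-+ c))
  where
  negate : ∀ x → + 2 * (- (1ℤ + x)) + 1ℤ ≡ - (+ 2 * x + 1ℤ)
  negate = solve-∀

-- Only odd arguments occur below, so the value at 0 (where 0 ^ 0 would give 1) is irrelevant.
_₊^_ : ℤ → ℕ → ℤ
+[1+ w ] ₊^ p = +[1+ w ] ℤ.^ p
_        ₊^ _ = 0ℤ

₊^-pos : ∀ {w c} p → w ≡ +[1+ c ] → w ₊^ p ≡ w ℤ.^ p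
₊^-pos p refl = refl

₊^-neg : ∀ {w c} p → w ≡ -[1+ c ] → w ₊^ p ≡ 0ℤ
₊^-neg p refl = refl

₊^-*-pos : ∀ β w p → (+[1+ β ] * w) ₊^ p ≡ +[1+ β ] ℤ.^ p * w ₊^ p
₊^-*-pos β (+ zero)  p = trans (cong (_₊^ p) (ℤP.*-zeroʳ +[1+ β ])) (sym (ℤP.*-zeroʳ (+[1+ β ] ℤ.^ p)))
₊^-*-pos β +[1+ w ]  p = ^-distribʳ-* +[1+ β ] +[1+ w ] p
₊^-*-pos β -[1+ w ]  p = sym (ℤP.*-zeroʳ (+[1+ β ] ℤ.^ p))

module Spline (m j : ℕ) where

  n : ℕ
  n = 2 ℕ.* m

  p : ℕ
  p = n ∸ j

  f : ℤ → ℤ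
  f t = (+ 2 * t + + suc n) ₊^ p

  φ : ℤ → ℤ
  φ = ∇^ 1ℤ (suc n) f

  private
    power-base : ∀ t {x} r → t + + m ≡ x → + 2 * (t - + r) + + suc n ≡ + 2 * (x - + r) + 1ℤ
    power-base t {x} r t+m≡x = begin
      + 2 * (t - + r) + (1ℤ + + n)        ≡⟨ cong (λ y → + 2 * (t - + r) + (1ℤ + y)) (ℤP.pos-* 2 m) ⟩
      + 2 * (t - + r) + (1ℤ + + 2 * + m)  ≡⟨ recentre t (+ r) (+ m) ⟩
      + 2 * (t + + m - + r) + 1ℤ          ≡⟨ cong (λ y → + 2 * (y - + r) + 1ℤ) t+m≡x ⟩
      + 2 * (x - + r) + 1ℤ ∎
      where
      open ≡-Reasoning
      recentre : ∀ t r m → + 2 * (t - r) + (1ℤ + + 2 * m) ≡ + 2 * (t + m - r) + 1ℤ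
      recentre = solve-∀

  f-reached : ∀ t {a} r → t + + m ≡ + a → r ≤ a → f (t - + r) ≡ (+ 2 * (t - + r) + + suc n) ℤ.^ p
  f-reached t {a} r t+m≡a r≤a =
    ₊^-pos p (trans (power-base t r t+m≡a) (trans (cong (λ y → + 2 * y + 1ℤ) (+-∸ r≤a)) (odd-+ (a ∸ r))))

  f-unreached : ∀ t {a} r → t + + m ≡ + a → f (t - + (suc a ℕ.+ r)) ≡ 0ℤ
  f-unreached t {a} r t+m≡a = ₊^-neg p (trans (power-base t (suc a ℕ.+ r) t+m≡a)
                                              (trans (cong (λ y → + 2 * y + 1ℤ) (+-overshoot a r)) (odd--[1+] r)))

  f-negative : ∀ t {a} r → t + + m ≡ -[1+ a ] → f (t - + r) ≡ 0ℤ
  f-negative t {a} r t+m≡-a =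
    ₊^-neg p (trans (power-base t r t+m≡-a) (trans (cong (λ y → + 2 * y + 1ℤ) (-[1+]-+ a r)) (odd--[1+] (a ℕ.+ r))))

  φ-below : ∀ {t a} → t + + m ≡ -[1+ a ] → φ t ≡ 0ℤ
  φ-below {t} t+m≡-a = trans (∇^-binomial (suc n) (suc (suc n)) ℕP.≤-refl f t)
    (∑<-zero (suc (suc n)) (λ r _ → trans (cong (signedBinomial (suc n) r *_) (f-negative t r t+m≡-a))
                                          (ℤP.*-zeroʳ (signedBinomial (suc n) r))))

  φ-above : ∀ {t a} → suc n ≤ a → t + + m ≡ + a → φ t ≡ 0ℤ
  φ-above {t} n<a t+m≡a = begin
    ∇^ 1ℤ (suc n) f t
      ≡⟨ ∇^-binomial (suc n) (suc (suc n)) ℕP.≤-refl f t ⟩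
    ∑< (suc (suc n)) (λ r → signedBinomial (suc n) r * f (t - + r))
      ≡⟨ ∑<-cong (suc (suc n)) (λ r r≤n+1 → cong (signedBinomial (suc n) r *_)
                                                 (f-reached t r t+m≡a (ℕP.≤-trans (ℕP.m<1+n⇒m≤n r≤n+1) n<a))) ⟩
    ∑< (suc (suc n)) (λ r → signedBinomial (suc n) r * poly (t - + r))
      ≡⟨ sym (∇^-binomial (suc n) (suc (suc n)) ℕP.≤-refl poly t) ⟩
    ∇^ 1ℤ (suc n) poly t
      ≡⟨ degreeBelow-mono poly (s≤s (ℕP.m∸n≤m n j)) (degreeBelow-^ (+ 2) (+ suc n) p) t ⟩
    0ℤ ∎
    where
    open ≡-Reasoning
    poly : ℤ → ℤ
    poly u = (+ 2 * u + + suc n) ℤ.^ p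

  vterm : ℤ → ℕ → ℤ
  vterm t r = sign r * + ((n ℕ.+ 1) C r) * ((+ n + + 2 * t - + 2 * + r + + 1) ℤ.^ p)

  vvec≡∑< : ∀ t {a} → t + + m ≡ + a → vvec n j t ≡ ∑< (suc a) (vterm t)
  vvec≡∑< t {a} t+m≡a = begin
    ∑ (upTo (suc ℤ.∣ t + + (n ℕ./ 2) ∣)) (vterm t)
      ≡⟨ cong (λ y → ∑ (upTo (suc ℤ.∣ t + + y ∣)) (vterm t)) n/2≡m ⟩
    ∑ (upTo (suc ℤ.∣ t + + m ∣)) (vterm t)
      ≡⟨ cong (λ y → ∑ (upTo (suc ℤ.∣ y ∣)) (vterm t)) t+m≡a ⟩
    ∑ (upTo (suc a)) (vterm t)
      ≡⟨ ∑-upTo (suc a) (vterm t) ⟩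
    ∑< (suc a) (vterm t) ∎
    where
    open ≡-Reasoning
    n/2≡m : n ℕ./ 2 ≡ m
    n/2≡m = trans (cong (ℕ._/ 2) (ℕP.*-comm 2 m)) (ℕD.m*n/n≡m m 2)

  φ-inside : ∀ t {a} → a ≤ n → t + + m ≡ + a → φ t ≡ vvec n j t
  φ-inside t {a} a≤n t+m≡a = begin
    φ t
      ≡⟨ ∇^-binomial (suc n) (suc a ℕ.+ (suc n ∸ a)) n+1<L f t ⟩
    ∑< (suc a ℕ.+ (suc n ∸ a)) g
      ≡⟨ ∑<-split (suc a) (suc n ∸ a) g ⟩
    ∑< (suc a) g + ∑< (suc n ∸ a) (λ r → g (suc a ℕ.+ r))
      ≡⟨ cong₂ _+_ (∑<-cong (suc a) (λ r r≤a → g≡vterm r (ℕP.m<1+n⇒m≤n r≤a)))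
                   (∑<-zero (suc n ∸ a) (λ r _ → trans (cong (c (suc a ℕ.+ r) *_) (f-unreached t r t+m≡a))
                                                        (ℤP.*-zeroʳ (c (suc a ℕ.+ r))))) ⟩
    ∑< (suc a) (vterm t) + 0ℤ
      ≡⟨ trans (ℤP.+-identityʳ _) (sym (vvec≡∑< t t+m≡a)) ⟩
    vvec n j t ∎
    where
    open ≡-Reasoning
    c : ℕ → ℤ
    c = signedBinomial (suc n)
    g : ℕ → ℤ
    g r = c r * f (t - + r)
    n+1<L : suc n < suc a ℕ.+ (suc n ∸ a)
    n+1<L = s≤s (ℕP.≤-reflexive (sym (ℕP.m+[n∸m]≡n (ℕP.m≤n⇒m≤1+n a≤n))))
    rearrange : ∀ n t r → + 2 * (t - r) + (1ℤ + n) ≡ n + + 2 * t - + 2 * r + + 1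
    rearrange = solve-∀
    g≡vterm : ∀ r → r ≤ a → g r ≡ vterm t r
    g≡vterm r r≤a = cong₂ _*_ (cong (λ N → sign r * + (N C r)) (ℕP.+-comm 1 n))
                              (trans (f-reached t r t+m≡a r≤a) (cong (ℤ._^ p) (rearrange (+ n) t (+ r))))

  φ≡extendByZero-vvec : ∀ t → φ t ≡ extendByZero m (vvec n j) t
  φ≡extendByZero-vvec t with offset m t
  ... | below eq      = trans (φ-below eq) (sym (extendByZero-unbalanced m (vvec n j) t (below⇒unbalanced eq)))
  ... | inside a≤n eq =
    trans (φ-inside t a≤n eq) (sym (extendByZero-balanced m (vvec n j) t (inside⇒balanced a≤n eq)))
  ... | above n<a eq  = trans (φ-above n<a eq) (sym (extendByZero-unbalanced m (vvec n j) t (above⇒unbalanced n<a eq)))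

  φ≡vvec : ∀ t → Balanced m t → φ t ≡ vvec n j t
  φ≡vvec t t-balanced = trans (φ≡extendByZero-vvec t) (extendByZero-balanced m (vvec n j) t t-balanced)

  f-rescale : ∀ (h : ℕ) u → f (u * + (2 ℕ.* h ℕ.+ 1) + + suc n * + h) ≡ (+ (2 ℕ.* h ℕ.+ 1)) ℤ.^ p * f u
  f-rescale h u = begin
    (+ 2 * (u * + (2 ℕ.* h ℕ.+ 1) + + suc n * + h) + + suc n) ₊^ p
      ≡⟨ cong (λ B → (+ 2 * (u * B + + suc n * + h) + + suc n) ₊^ p) (trans b≡ (sym b₀≡)) ⟩
    (+ 2 * (u * b₀ + + suc n * + h) + + suc n) ₊^ p
      ≡⟨ cong (_₊^ p) (factor u (+ h) (+ suc n)) ⟩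
    (b₀ * (+ 2 * u + + suc n)) ₊^ p
      ≡⟨ cong (λ B → (B * (+ 2 * u + + suc n)) ₊^ p) b₀≡ ⟩
    (+[1+ 2 ℕ.* h ] * (+ 2 * u + + suc n)) ₊^ p
      ≡⟨ ₊^-*-pos (2 ℕ.* h) (+ 2 * u + + suc n) p ⟩
    +[1+ 2 ℕ.* h ] ℤ.^ p * f u
      ≡⟨ cong (λ B → B ℤ.^ p * f u) (sym b≡) ⟩
    (+ (2 ℕ.* h ℕ.+ 1)) ℤ.^ p * f u ∎
    where
    open ≡-Reasoning
    b₀ : ℤ
    b₀ = 1ℤ + + 2 * + h
    b≡ : + (2 ℕ.* h ℕ.+ 1) ≡ +[1+ 2 ℕ.* h ]
    b≡ = cong +_ (ℕP.+-comm (2 ℕ.* h) 1)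
    b₀≡ : b₀ ≡ +[1+ 2 ℕ.* h ]
    b₀≡ = trans (ℤP.+-comm 1ℤ (+ 2 * + h)) (odd-+ h)
    factor : ∀ u h N → + 2 * (u * (1ℤ + + 2 * h) + N * h) + N ≡ (1ℤ + + 2 * h) * (+ 2 * u + N)
    factor = solve-∀

  ∑-vvec-carryCount : ∀ h k → Balanced m k →
    ∑ (states m) (λ i → vvec n j i * + carryCount (2 ℕ.* h ℕ.+ 1) n i k)
      ≡ (+ (2 ℕ.* h ℕ.+ 1)) ℤ.^ p * vvec n j k
  ∑-vvec-carryCount h k k-balanced = begin
    ∑ (states m) (λ i → vvec n j i * + carryCount b n i k)
      ≡⟨ ∑-carryCount m n (vvec n j) k ⟩
    ∑ (tuples b (suc n)) (λ ys → extendByZero m (vvec n j) (k * + b - sumℤ ys))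
      ≡⟨ ∑-cong (tuples b (suc n)) (λ ys → sym (φ≡extendByZero-vvec (k * + b - sumℤ ys))) ⟩
    ∑ (tuples b (suc n)) (λ ys → φ (k * + b - sumℤ ys))
      ≡⟨ ∑-tuples-∇^ (suc n) f (k * + b) ⟩
    ∇^ (+ b) (suc n) f (k * + b + + suc n * + h)
      ≡⟨ ∇^-rescale (suc n) (+ b) (+ suc n * + h) ((+ b) ℤ.^ p) f f (f-rescale h) k ⟩
    (+ b) ℤ.^ p * φ k
      ≡⟨ cong ((+ b) ℤ.^ p *_) (φ≡vvec k k-balanced) ⟩
    (+ b) ℤ.^ p * vvec n j k ∎
    where
    open ≡-Reasoning
    open OddBase h

/-≡ : ∀ a c x y .{{_ : NonZero x}} .{{_ : NonZero y}} → a * + y ≡ c * + x → a / x ≡ c / y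
/-≡ a c (suc x) (suc y) eq = ℚP.fromℚᵘ-cong {ℚᵘ.mkℚᵘ a x} {ℚᵘ.mkℚᵘ c y} (ℚᵘ.*≡* eq)

toℚᵘ-/ : ∀ a x .{{_ : NonZero x}} → toℚᵘ (a / x) ℚᵘ.≃ (a ℚᵘ./ x)
toℚᵘ-/ a (suc x) = ℚP.toℚᵘ-fromℚᵘ (ℚᵘ.mkℚᵘ a x)

/-*-/ : ∀ a c x y .{{_ : NonZero x}} .{{_ : NonZero y}} →
        (a / x) ℚ.* (c / y) ≡ ((a * c) / (x ℕ.* y)) {{ℕP.m*n≢0 x y}}
/-*-/ a c x@(suc _) y@(suc _) = ℚP.toℚᵘ-injective (begin
  toℚᵘ ((a / x) ℚ.* (c / y))                 ≈⟨ ℚP.toℚᵘ-homo-* (a / x) (c / y) ⟩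
  toℚᵘ (a / x) ℚᵘ.* toℚᵘ (c / y)             ≈⟨ ℚᵘP.*-cong (toℚᵘ-/ a x) (toℚᵘ-/ c y) ⟩
  (a ℚᵘ./ x) ℚᵘ.* (c ℚᵘ./ y)                 ≈⟨ ℚᵘP.≃-sym (toℚᵘ-/ (a * c) (x ℕ.* y)) ⟩
  toℚᵘ ((a * c) / (x ℕ.* y))                 ∎)
  where open ℚᵘP.≃-Reasoning

/-+-/ : ∀ a c x .{{_ : NonZero x}} → (a / x) ℚ.+ (c / x) ≡ (a + c) / x
/-+-/ a c x@(suc _) = ℚP.toℚᵘ-injective (begin
  toℚᵘ ((a / x) ℚ.+ (c / x))                 ≈⟨ ℚP.toℚᵘ-homo-+ (a / x) (c / x) ⟩
  toℚᵘ (a / x) ℚᵘ.+ toℚᵘ (c / x)             ≈⟨ ℚᵘP.+-cong (toℚᵘ-/ a x) (toℚᵘ-/ c x) ⟩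
  (a ℚᵘ./ x) ℚᵘ.+ (c ℚᵘ./ x)                 ≈⟨ ℚᵘ.*≡* (distrib a c (+ x)) ⟩
  (a + c) ℚᵘ./ x                             ≈⟨ ℚᵘP.≃-sym (toℚᵘ-/ (a + c) x) ⟩
  toℚᵘ ((a + c) / x)                         ∎)
  where
  open ℚᵘP.≃-Reasoning
  distrib : ∀ a c x → (a * x + c * x) * x ≡ (a + c) * (x * x)
  distrib = solve-∀

sumℚ-ℤtoℚ-*-/ : ∀ B .{{_ : NonZero B}} (xs : List ℤ) (F G : ℤ → ℤ) →
  sumℚ (map (λ i → ℤtoℚ (F i) ℚ.* (G i / B)) xs) ≡ ∑ xs (λ i → F i * G i) / B
sumℚ-ℤtoℚ-*-/ B []       F G = sym (ℚP.0/n≡0 B)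
sumℚ-ℤtoℚ-*-/ B (x ∷ xs) F G = begin
  ℤtoℚ (F x) ℚ.* (G x / B) ℚ.+ sumℚ (map (λ i → ℤtoℚ (F i) ℚ.* (G i / B)) xs)
    ≡⟨ cong₂ ℚ._+_ (ℤtoℚ-*-/ (F x) (G x)) (sumℚ-ℤtoℚ-*-/ B xs F G) ⟩
  (F x * G x) / B ℚ.+ ∑ xs (λ i → F i * G i) / B
    ≡⟨ /-+-/ (F x * G x) (∑ xs (λ i → F i * G i)) B ⟩
  (F x * G x + ∑ xs (λ i → F i * G i)) / B ∎
  where
  open ≡-Reasoning
  ℤtoℚ-*-/ : ∀ a c → ℤtoℚ a ℚ.* (c / B) ≡ (a * c) / B
  ℤtoℚ-*-/ a c = trans (/-*-/ a c 1 B)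
    (/-≡ (a * c) (a * c) (1 ℕ.* B) B {{ℕP.m*n≢0 1 B}} (cong (λ z → a * c * + z) (sym (ℕP.*-identityˡ B))))

pos-^ : ∀ b q → + (b ^ q) ≡ (+ b) ℤ.^ q
pos-^ b zero    = refl
pos-^ b (suc q) = trans (ℤP.pos-* b (b ^ q)) (cong (+ b *_) (pos-^ b q))

/-^-cancel : ∀ b j n v .{{_ : NonZero b}} → j ≤ n →
  (((+ b) ℤ.^ (n ∸ j) * v) / b ^ n) {{m^n≢0 b n}} ≡ ((1ℤ / b ^ j) {{m^n≢0 b j}}) ℚ.* ℤtoℚ v
/-^-cancel b j n v j≤n = begin
  ((+ b) ℤ.^ (n ∸ j) * v) / b ^ n
    ≡⟨ /-≡ ((+ b) ℤ.^ (n ∸ j) * v) (1ℤ * v) (b ^ n) (b ^ j ℕ.* 1) cross ⟩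
  (1ℤ * v) / (b ^ j ℕ.* 1)
    ≡⟨ sym (/-*-/ 1ℤ v (b ^ j) 1) ⟩
  (1ℤ / b ^ j) ℚ.* ℤtoℚ v ∎
  where
  open ≡-Reasoning
  instance
    bⁿ≢0 : NonZero (b ^ n)
    bⁿ≢0 = m^n≢0 b n
    bʲ≢0 : NonZero (b ^ j)
    bʲ≢0 = m^n≢0 b j
    bʲ*1≢0 : NonZero (b ^ j ℕ.* 1)
    bʲ*1≢0 = ℕP.m*n≢0 (b ^ j) 1
  pow : ℕ → ℤ
  pow e = (+ b) ℤ.^ e
  regroup : ∀ P v J → P * v * J ≡ 1ℤ * v * (P * J)
  regroup = solve-∀
  cross : pow (n ∸ j) * v * + (b ^ j ℕ.* 1) ≡ 1ℤ * v * + (b ^ n)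
  cross = begin
    pow (n ∸ j) * v * + (b ^ j ℕ.* 1)    ≡⟨ cong (λ e → pow (n ∸ j) * v * + e) (ℕP.*-identityʳ (b ^ j)) ⟩
    pow (n ∸ j) * v * + (b ^ j)          ≡⟨ cong (pow (n ∸ j) * v *_) (pos-^ b j) ⟩
    pow (n ∸ j) * v * pow j                ≡⟨ regroup (pow (n ∸ j)) v (pow j) ⟩
    1ℤ * v * (pow (n ∸ j) * pow j)         ≡⟨ cong (1ℤ * v *_) (sym (ℤP.^-distribˡ-+-* (+ b) (n ∸ j) j)) ⟩
    1ℤ * v * pow (n ∸ j ℕ.+ j)           ≡⟨ cong (λ e → 1ℤ * v * pow e) (ℕP.m∸n+n≡m j≤n) ⟩
    1ℤ * v * pow n                       ≡⟨ cong (1ℤ * v *_) (sym (pos-^ b n)) ⟩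
    1ℤ * v * + (b ^ n)                 ∎

theorem3p1 : (b m : ℕ) → (∃ λ t → b ≡ 2 ℕ.* t ℕ.+ 1) → 3 ≤ b → {{_ : NonZero b}}
    → 1 ≤ m → (j : ℕ) → j ≤ 2 ℕ.* m → (k : ℤ) → ℤ.- (+ m) ℤ.≤ k → k ℤ.≤ + m
    → sumℚ (map (λ i → ℤtoℚ (vvec (2 ℕ.* m) j i) ℚ.* K b (2 ℕ.* m) i k) (states m))
      ≡ ((+ 1) / (b ^ j)) {{m^n≢0 b j}} ℚ.* ℤtoℚ (vvec (2 ℕ.* m) j k)
theorem3p1 .(2 ℕ.* h ℕ.+ 1) m (h , refl) _ _ j j≤n k -m≤k k≤m = begin
  sumℚ (map (λ i → ℤtoℚ (vvec n j i) ℚ.* K b n i k) (states m))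
    ≡⟨ sumℚ-ℤtoℚ-*-/ (b ^ n) (states m) (vvec n j) (λ i → + carryCount b n i k) ⟩
  ∑ (states m) (λ i → vvec n j i * + carryCount b n i k) / b ^ n
    ≡⟨ cong (_/ b ^ n) (Spline.∑-vvec-carryCount m j h k (-m≤k , k≤m)) ⟩
  ((+ b) ℤ.^ (n ∸ j) * vvec n j k) / b ^ n
    ≡⟨ /-^-cancel b j n (vvec n j k) j≤n ⟩
  ((+ 1) / b ^ j) ℚ.* ℤtoℚ (vvec n j k) ∎
  where
  open ≡-Reasoning
  b n : ℕ
  b = 2 ℕ.* h ℕ.+ 1
  n = 2 ℕ.* m
  instance
    bⁿ≢0 : NonZero (b ^ n)
    bⁿ≢0 = m^n≢0 b n
    bʲ≢0 : NonZero (b ^ j)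
    bʲ≢0 = m^n≢0 b j
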